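{- Let $n=2k+1$ with $k\geq 2$ and let $S_n$ be the $n$-sunlet graph. Then $\psi_E(S_n)=3$.
   Context: All graphs are simple, connected and undirected. The $n$-sunlet graph $S_n$ is obtained from the cycle $C_n$ by attaching one pendant edge at each vertex of the cycle. For a graph $G$, the edge distance $d_E(f,g)$ between edges $f,g\in E(G)$ is the distance between $f$ and $g$ as vertices of the line graph $L(G)$. Two edges $f,g$ are said to edge doubly resolve edges $f_1,f_2$ if $d_E(f_1,f)-d_E(f_1,g)\neq d_E(f_2,f)-d_E(f_2,g)$. A set $D_E\subseteq E(G)$ is an edge version of doubly resolving set of $G$ if every pair of distinct edges $e\neq f$ of $G$ is edge doubly resolved by some two edges of $D_E$. $\psi_E(G)$ denotes the minimum cardinality of an edge version of doubly resolving set of $G$. -}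

module Defs where

open import Data.Nat using (ℕ; zero; suc; _≤_; NonZero)
open import Data.Nat.DivMod using (_mod_)
open import Data.Fin using (Fin; toℕ)
open import Data.Integer using (ℤ; +_; _-_)
open import Data.Sum using (_⊎_; inj₁; inj₂)
open import Data.Product using (Σ; _×_; _,_; ∃; ∃-syntax)
open import Data.List using (List; length)
open import Data.List.Membership.Propositional using (_∈_)
open import Data.List.Relation.Unary.Unique.Propositional using (Unique)
open import Relation.Binary.PropositionalEquality using (_≡_; _≢_)

data Walk {A : Set} (R : A → A → Set) : A → A → ℕ → Set where
  nil  : ∀ {x} → Walk R x x zero
  cons : ∀ {x y z ℓ} → R x y → Walk R y z ℓ → Walk R x z (suc ℓ)

Dist : {A : Set} → (A → A → Set) → A → A → ℕ → Set
Dist R x y d = Walk R x y d × (∀ m → Walk R x y m → d ≤ m)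

LineAdj : {E V : Set} → (E → V → Set) → E → E → Set
LineAdj {E} {V} inc e f = e ≢ f × Σ V (λ v → inc e v × inc f v)

-- The n-sunlet graph S_n.  Vertices: inj₁ i = cycle vertex v_i,
-- inj₂ i = pendant vertex u_i  (i ∈ Fin n).
SVertex : ℕ → Set
SVertex n = Fin n ⊎ Fin n

-- Edges: inj₁ i = cycle edge v_i v_{i+1 mod n};  inj₂ i = pendant edge v_i u_i.
SEdge : ℕ → Set
SEdge n = Fin n ⊎ Fin n

sucMod : (n : ℕ) .{{_ : NonZero n}} → Fin n → Fin n
sucMod n i = suc (toℕ i) mod n

data SInc (n : ℕ) .{{_ : NonZero n}} : SEdge n → SVertex n → Set where
  cyc-left  : ∀ i → SInc n (inj₁ i) (inj₁ i)
  cyc-right : ∀ i → SInc n (inj₁ i) (inj₁ (sucMod n i))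
  pen-cycle : ∀ i → SInc n (inj₂ i) (inj₁ i)
  pen-leaf  : ∀ i → SInc n (inj₂ i) (inj₂ i)

SLineAdj : (n : ℕ) .{{_ : NonZero n}} → SEdge n → SEdge n → Set
SLineAdj n = LineAdj (SInc n)

EdgeDist : (n : ℕ) .{{_ : NonZero n}} → SEdge n → SEdge n → ℕ → Set
EdgeDist n = Dist (SLineAdj n)

DoublyResolves : {E : Set} → (E → E → Set) → E → E → E → E → Set
DoublyResolves L f g f₁ f₂ =
  ∀ a b c d → Dist L f₁ f a → Dist L f₁ g b → Dist L f₂ f c → Dist L f₂ g d →
  ((+ a) - (+ b)) ≢ ((+ c) - (+ d))

IsEdgeDRS : {E : Set} → (E → E → Set) → List E → Set
IsEdgeDRS L D = ∀ e f → e ≢ f →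
  ∃[ g ] ∃[ h ] (g ∈ D × h ∈ D × DoublyResolves L g h e f)

-- ψ_E = m : some edge DRS (duplicate-free list = set) has m elements and
-- every edge DRS has at least m elements.
PsiE≡ : {E : Set} → (E → E → Set) → ℕ → Set
PsiE≡ L m =
  (Σ (List _) λ D → Unique D × length D ≡ m × IsEdgeDRS L D) ×
  (∀ D → Unique D → IsEdgeDRS L D → m ≤ length D)

module Submission where

-- Upper bound.  Number the cycle edges c₀ … c_{2k} and the pendant edges
-- p₀ … p_{2k}, and take the middle edges cₖ, pₖ together with p₀.  Distances to
-- a fixed edge are computed by potentials: a function that changes by at most
-- one between meeting edges is a lower bound for the distance to its zero, and
-- equals it once walks of that length are exhibited.  For cₖ and pₖ the
-- potentials are the distances in the comb (the path of cycle edges with its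
-- pendants), as no edge is more than k steps from the middle; for p₀ they are
-- the rotation by k of those for pₖ.  From the differences d(e,cₖ) - d(e,pₖ) and
-- d(e,cₖ) - d(e,p₀) the edge e can be read off, so two edges that cₖ, pₖ fail to
-- separate are separated by cₖ, p₀.
--
-- Lower bound.  With two edges g, h only the difference d(e,g) - d(e,h) can
-- separate pairs; all distances are at most k + 2, so this difference takes at
-- most 2k + 5 < 4k + 2 values and two of the 4k + 2 edges share it.

open import Defs
open import Data.Nat using (ℕ; zero; suc; pred; _+_; _*_; _∸_; _≤_; _<_; z≤n; s≤s; s≤s⁻¹;
                            NonZero; ≢-nonZero⁻¹; >-nonZero; _%_; ∣_-_∣)
open import Data.Nat.Properties
open import Data.Nat.DivMod
  using (n%n≡0; m<n⇒m%n≡m; m%n<n; m%n%n≡m%n; %-distribˡ-+; [m+n]%n≡m%n)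
open import Data.Nat.Tactic.RingSolver using (solve-∀)
import Data.Integer as ℤ
open import Data.Integer.Properties using (+-injective; pos-+)
import Data.Integer.Tactic.RingSolver as ℤ-Solver
open import Data.Fin using (Fin; toℕ; fromℕ<; splitAt; join)
import Data.Fin as Fin
open import Data.Fin.Properties
  using (toℕ-injective; toℕ<n; toℕ-fromℕ<; any?; pigeonhole; join-splitAt) renaming (_≟_ to _≟ᶠ_)
open import Data.Product using (Σ; _×_; _,_; proj₁; proj₂)
open import Data.Sum using (_⊎_; inj₁; inj₂)
open import Data.Sum.Properties using (inj₁-injective; inj₂-injective; ≡-dec)
open import Data.Empty using (⊥-elim)
open import Data.List using (List; []; _∷_; length)
open import Data.List.Membership.Propositional using (_∈_)
open import Data.List.Relation.Unary.Any using (here; there)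
open import Data.List.Relation.Unary.All using ([]; _∷_)
open import Data.List.Relation.Unary.AllPairs using ([]; _∷_)
open import Data.List.Relation.Unary.Unique.Propositional using (Unique)
open import Relation.Nullary using (Dec; yes; no; ¬_)
open import Relation.Nullary.Decidable using (map′; _×-dec_; _⊎-dec_; ¬?)
open import Relation.Binary.Definitions using (DecidableEquality)
open import Relation.Binary.PropositionalEquality

module _ where
  open ℤ using (+_)

  diff≡⇒sum≡ : ∀ a b c d → + a ℤ.- + b ≡ + c ℤ.- + d → a + d ≡ c + b
  diff≡⇒sum≡ a b c d eq = +-injective (begin
    + (a + d)                         ≡⟨ pos-+ a d ⟩
    + a ℤ.+ + d                       ≡⟨ regroup (+ a) (+ b) (+ d) ⟩
    (+ a ℤ.- + b) ℤ.+ (+ b ℤ.+ + d)   ≡⟨ cong (ℤ._+ (+ b ℤ.+ + d)) eq ⟩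
    (+ c ℤ.- + d) ℤ.+ (+ b ℤ.+ + d)   ≡⟨ cancel (+ c) (+ b) (+ d) ⟩
    + c ℤ.+ + b                       ≡⟨ pos-+ c b ⟨
    + (c + b)                         ∎)
    where
    open ≡-Reasoning
    regroup : ∀ x y z → x ℤ.+ z ≡ (x ℤ.- y) ℤ.+ (y ℤ.+ z)
    regroup = ℤ-Solver.solve-∀
    cancel : ∀ x y z → (x ℤ.- z) ℤ.+ (y ℤ.+ z) ≡ x ℤ.+ y
    cancel = ℤ-Solver.solve-∀

  sum≡⇒diff≡ : ∀ a b c d → a + d ≡ c + b → + a ℤ.- + b ≡ + c ℤ.- + d
  sum≡⇒diff≡ a b c d eq = begin
    + a ℤ.- + b                       ≡⟨ extend (+ a) (+ b) (+ d) ⟩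
    (+ a ℤ.+ + d) ℤ.- (+ b ℤ.+ + d)   ≡⟨ cong (ℤ._- (+ b ℤ.+ + d)) sums ⟩
    (+ c ℤ.+ + b) ℤ.- (+ b ℤ.+ + d)   ≡⟨ cancel (+ c) (+ b) (+ d) ⟩
    + c ℤ.- + d                       ∎
    where
    open ≡-Reasoning
    sums : + a ℤ.+ + d ≡ + c ℤ.+ + b
    sums = trans (sym (pos-+ a d)) (trans (cong +_ eq) (pos-+ c b))
    extend : ∀ x y z → x ℤ.- y ≡ (x ℤ.+ z) ℤ.- (y ℤ.+ z)
    extend = ℤ-Solver.solve-∀
    cancel : ∀ x y z → (x ℤ.+ y) ℤ.- (y ℤ.+ z) ≡ x ℤ.- z
    cancel = ℤ-Solver.solve-∀

least : {P : ℕ → Set} → (∀ m → Dec (P m)) → ∀ {L} → P L →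
        Σ ℕ λ d → P d × (∀ m → P m → d ≤ m)
least P? {zero} p = 0 , p , λ _ _ → z≤n
least P? {suc L} p with P? 0
... | yes p₀ = 0 , p₀ , λ _ _ → z≤n
... | no ¬p₀ with least (λ m → P? (suc m)) p
...   | d , pd , minimal = suc d , pd , λ { zero p₀ → ⊥-elim (¬p₀ p₀)
                                         ; (suc m) pm → s≤s (minimal m pm) }

module _ {A : Set} {R : A → A → Set} where

  snocʷ : ∀ {x y z m} → Walk R x y m → R y z → Walk R x z (suc m)
  snocʷ nil r = cons r nil
  snocʷ (cons r p) s = cons r (snocʷ p s)

  _++ʷ_ : ∀ {x y z m n} → Walk R x y m → Walk R y z n → Walk R x z (m + n)
  nil ++ʷ q = q
  cons r p ++ʷ q = cons r (p ++ʷ q)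

  reverseʷ : (∀ {x y} → R x y → R y x) → ∀ {x y m} → Walk R x y m → Walk R y x m
  reverseʷ R-sym nil = nil
  reverseʷ R-sym (cons r p) = snocʷ (reverseʷ R-sym p) (R-sym r)

  dist-unique : ∀ {x y a b} → Dist R x y a → Dist R x y b → a ≡ b
  dist-unique (wa , min-a) (wb , min-b) = ≤-antisym (min-a _ wb) (min-b _ wa)

  module _ (φ : A → ℕ) (lipschitz : ∀ {x y} → R x y → φ x ≤ suc (φ y)) where

    potential-≤ : ∀ {x y m} → Walk R x y m → φ x ≤ m + φ y
    potential-≤ nil = ≤-refl
    potential-≤ (cons r p) = ≤-trans (lipschitz r) (s≤s (potential-≤ p))

    potential-dist : ∀ {x s} → φ s ≡ 0 → Walk R x s (φ x) → Dist R x s (φ x)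
    potential-dist φs≡0 w = w , λ m w′ →
      ≤-trans (potential-≤ w′) (≤-reflexive (trans (cong (m +_) φs≡0) (+-identityʳ m)))

-- In a graph with decidable equality and adjacency whose vertices can be searched,
-- the existence of a walk of given length is decidable, so any two vertices joined
-- by a walk have a distance, at most the length of that walk.
module ShortestWalks {A : Set} (R : A → A → Set)
  (_≟ᵥ_ : DecidableEquality A) (R? : ∀ x y → Dec (R x y))
  (search : {P : A → Set} → (∀ a → Dec (P a)) → Dec (Σ A P)) where

  walk? : ∀ m x y → Dec (Walk R x y m)
  walk? zero x y = map′ (λ { refl → nil }) (λ { nil → refl }) (x ≟ᵥ y)
  walk? (suc m) x y = map′ (λ { (z , r , w) → cons r w }) (λ { (cons r w) → _ , r , w })
                           (search (λ z → R? x z ×-dec walk? m z y))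

  dist-exists : ∀ {x y L} → Walk R x y L → Σ ℕ λ d → Dist R x y d × d ≤ L
  dist-exists {x} {y} {L} w with least (λ m → walk? m x y) w
  ... | d , wd , minimal = d , (wd , minimal) , minimal L w

module _ {E : Set} (L : E → E → Set) where

  DistanceTo : E → (E → ℕ) → Set
  DistanceTo g dᵍ = ∀ e a → Dist L e g a → a ≡ dᵍ e

  resolves : ∀ {g h dᵍ dʰ e f} → DistanceTo g dᵍ → DistanceTo h dʰ →
             dᵍ e + dʰ f ≢ dᵍ f + dʰ e → DoublyResolves L g h e f
  resolves {dᵍ = dᵍ} {dʰ} {e} {f} toG toH apart a b c d ea eb fc fd diff = apart (begin
    dᵍ e + dʰ f  ≡⟨ cong₂ _+_ (toG e a ea) (toH f d fd) ⟨
    a + d        ≡⟨ diff≡⇒sum≡ a b c d diff ⟩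
    c + b        ≡⟨ cong₂ _+_ (toG f c fc) (toH e b eb) ⟩
    dᵍ f + dʰ e  ∎)
    where open ≡-Reasoning

  three-resolving : ∀ {g h₁ h₂ dᵍ d₁ d₂} →
    DistanceTo g dᵍ → DistanceTo h₁ d₁ → DistanceTo h₂ d₂ →
    (∀ e f → dᵍ e + d₁ f ≡ dᵍ f + d₁ e → dᵍ e + d₂ f ≡ dᵍ f + d₂ e → e ≡ f) →
    IsEdgeDRS L (g ∷ h₁ ∷ h₂ ∷ [])
  three-resolving {g} {h₁} {h₂} {dᵍ} {d₁} toG to₁ to₂ determined e f e≢f
    with dᵍ e + d₁ f ≟ dᵍ f + d₁ e
  ... | no apart₁ = g , h₁ , here refl , there (here refl) , resolves toG to₁ apart₁
  ... | yes same₁ = g , h₂ , here refl , there (there (here refl)) ,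
                    resolves toG to₂ (λ same₂ → e≢f (determined e f same₁ same₂))

∸-from-+ : ∀ {x b a} → x + b ≡ a → a ∸ b ≡ x
∸-from-+ {x} {b} refl = m+n∸n≡m x b

offset-diff-cong : ∀ B a b c d → a + d ≡ c + b → (a + B) ∸ b ≡ (c + B) ∸ d
offset-diff-cong B a b c d eq = begin
  (a + B) ∸ b              ≡⟨ [m+n]∸[m+o]≡n∸o d (a + B) b ⟨
  (d + (a + B)) ∸ (d + b)  ≡⟨ cong₂ _∸_ shifted (+-comm d b) ⟩
  (b + (c + B)) ∸ (b + d)  ≡⟨ [m+n]∸[m+o]≡n∸o b (c + B) d ⟩
  (c + B) ∸ d              ∎
  where
  open ≡-Reasoning
  rearrange : ∀ p q r → p + (q + r) ≡ (q + p) + r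
  rearrange = solve-∀
  shifted : d + (a + B) ≡ b + (c + B)
  shifted = begin
    d + (a + B)  ≡⟨ rearrange d a B ⟩
    (a + d) + B  ≡⟨ cong (_+ B) eq ⟩
    (c + b) + B  ≡⟨ rearrange b c B ⟨
    b + (c + B)  ∎

offset-diff-injective : ∀ B x b y d → b ≤ x + B → d ≤ y + B →
                        (x + B) ∸ b ≡ (y + B) ∸ d → x + d ≡ y + b
offset-diff-injective B x b y d b≤ d≤ eq = +-cancelʳ-≡ B _ _ (begin
  (x + d) + B                  ≡⟨ swap x d B ⟩
  (x + B) + d                  ≡⟨ cong (_+ d) (m∸n+n≡m b≤) ⟨
  ((x + B) ∸ b + b) + d        ≡⟨ cong (λ z → (z + b) + d) eq ⟩
  ((y + B) ∸ d + b) + d        ≡⟨ swap ((y + B) ∸ d) b d ⟩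
  ((y + B) ∸ d + d) + b        ≡⟨ cong (_+ b) (m∸n+n≡m d≤) ⟩
  (y + B) + b                  ≡⟨ swap y B b ⟩
  (y + b) + B                  ∎)
  where
  open ≡-Reasoning
  swap : ∀ p q r → (p + q) + r ≡ (p + r) + q
  swap = solve-∀

-- With only two edges g, h available a pair e₁, e₂ can only be doubly resolved
-- through the difference d(e,g) - d(e,h).  If all distances are at most B this
-- difference takes at most 2B + 1 values, so among more than 2B + 1 edges two
-- share it: every doubly resolving set has at least three edges.
module AtLeastThree {E : Set} (L : E → E → Set) (dist : E → E → ℕ)
  (dist-spec : ∀ e g → Dist L e g (dist e g)) (B : ℕ) (dist-≤ : ∀ e g → dist e g ≤ B)
  {M : ℕ} (enum : Fin M → E) (enum-injective : ∀ {x y} → enum x ≡ enum y → x ≡ y)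
  (many : suc (B + B) < M) where

  -- (d(e,g) + B) ∸ d(e,h) encodes d(e,g) - d(e,h) ∈ [-B, B] by a natural ≤ 2B.
  encoded-diff : E → E → E → ℕ
  encoded-diff g h e = (dist e g + B) ∸ dist e h

  encoded-diff< : ∀ g h e → encoded-diff g h e < suc (B + B)
  encoded-diff< g h e = s≤s (≤-trans (m∸n≤m _ (dist e h)) (+-monoˡ-≤ B (dist-≤ e g)))

  Balanced : E → E → E → E → Set
  Balanced g h e₁ e₂ = dist e₁ g + dist e₂ h ≡ dist e₂ g + dist e₁ h

  collision : ∀ g h → Σ E λ e₁ → Σ E λ e₂ → e₁ ≢ e₂ × Balanced g h e₁ e₂
  collision g h with pigeonhole many (λ x → fromℕ< (encoded-diff< g h (enum x)))
  ... | x₁ , x₂ , x₁<x₂ , same = enum x₁ , enum x₂ , distinct ,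
      offset-diff-injective B _ _ _ _ (bound (enum x₁)) (bound (enum x₂)) (begin
        encoded-diff g h (enum x₁)                        ≡⟨ toℕ-fromℕ< _ ⟨
        toℕ (fromℕ< (encoded-diff< g h (enum x₁)))        ≡⟨ cong toℕ same ⟩
        toℕ (fromℕ< (encoded-diff< g h (enum x₂)))        ≡⟨ toℕ-fromℕ< _ ⟩
        encoded-diff g h (enum x₂)                        ∎)
    where
    open ≡-Reasoning
    distinct : enum x₁ ≢ enum x₂
    distinct eq = <-irrefl (cong toℕ (enum-injective eq)) x₁<x₂
    bound : ∀ e → dist e h ≤ dist e g + B
    bound e = ≤-trans (dist-≤ e h) (m≤n+m B (dist e g))

  balanced : ∀ {g h e₁ e₂ x y} → Balanced g h e₁ e₂ → x ≡ g ⊎ x ≡ h → y ≡ g ⊎ y ≡ h →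
             dist e₁ x + dist e₂ y ≡ dist e₂ x + dist e₁ y
  balanced bal (inj₁ refl) (inj₂ refl) = bal
  balanced {e₁ = e₁} {e₂} {x} {y} bal (inj₂ refl) (inj₁ refl) =
    trans (+-comm (dist e₁ x) (dist e₂ y)) (trans (sym bal) (+-comm (dist e₁ y) (dist e₂ x)))
  balanced {e₁ = e₁} {e₂} {x} bal (inj₁ refl) (inj₁ refl) = +-comm (dist e₁ x) (dist e₂ x)
  balanced {e₁ = e₁} {e₂} {x} bal (inj₂ refl) (inj₂ refl) = +-comm (dist e₁ x) (dist e₂ x)

  covered-not-resolving : ∀ g h D → (∀ {x} → x ∈ D → x ≡ g ⊎ x ≡ h) → ¬ IsEdgeDRS L D
  covered-not-resolving g h D covered drs with collision g h
  ... | e₁ , e₂ , e₁≢e₂ , bal with drs e₁ e₂ e₁≢e₂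
  ...   | x , y , x∈D , y∈D , resolved =
    resolved _ _ _ _ (dist-spec e₁ x) (dist-spec e₁ y) (dist-spec e₂ x) (dist-spec e₂ y)
             (sum≡⇒diff≡ (dist e₁ x) (dist e₁ y) (dist e₂ x) (dist e₂ y)
                         (balanced bal (covered x∈D) (covered y∈D)))

  lower-bound : ∀ D → IsEdgeDRS L D → 3 ≤ length D
  lower-bound [] drs = ⊥-elim (covered-not-resolving some some [] (λ ()) drs)
    where some = enum (fromℕ< (<-trans (s≤s z≤n) many))
  lower-bound (g ∷ []) drs = ⊥-elim (covered-not-resolving g g _ (λ { (here p) → inj₁ p }) drs)
  lower-bound (g ∷ h ∷ []) drs = ⊥-elim (covered-not-resolving g h _
    (λ { (here p) → inj₁ p ; (there (here p)) → inj₂ p }) drs)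
  lower-bound (_ ∷ _ ∷ _ ∷ _) _ = s≤s (s≤s (s≤s z≤n))

Close : ℕ → ℕ → Set
Close x y = x ≤ suc y × y ≤ suc x

close-refl : ∀ x → Close x x
close-refl x = n≤1+n x , n≤1+n x

close-suc : ∀ x → Close x (suc x)
close-suc x = m≤n⇒m≤1+n (n≤1+n x) , ≤-refl

close-sym : ∀ {x y} → Close x y → Close y x
close-sym (x≤ , y≤) = y≤ , x≤

-- Distances in the line graph of the infinite comb, the path c₀ c₁ c₂ … of
-- cycle edges with a pendant edge pₜ at the common end of c_{t-1} and cₜ:
-- d(cₐ, c_b) = ∣ a - b ∣,  d(pₐ, c_b) = dpc a b  and  d(pₐ, p_b) = dpp a b.
dpc : ℕ → ℕ → ℕ
dpc zero b = suc b
dpc (suc a) zero = suc a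
dpc (suc a) (suc b) = dpc a b

dpp : ℕ → ℕ → ℕ
dpp zero zero = 0
dpp zero (suc b) = suc (suc b)
dpp (suc a) zero = suc (suc a)
dpp (suc a) (suc b) = dpp a b

dpc-right : ∀ a d → dpc a (a + d) ≡ suc d
dpc-right zero d = refl
dpc-right (suc a) d = dpc-right a d

dpc-left : ∀ b d → dpc (b + suc d) b ≡ suc d
dpc-left zero d = refl
dpc-left (suc b) d = dpc-left b d

dpp-self : ∀ a → dpp a a ≡ 0
dpp-self zero = refl
dpp-self (suc a) = dpp-self a

dpp-right : ∀ a d → dpp a (a + suc d) ≡ suc (suc d)
dpp-right zero d = refl
dpp-right (suc a) d = dpp-right a d

dpp-left : ∀ b d → dpp (b + suc d) b ≡ suc (suc d)
dpp-left zero d = refl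
dpp-left (suc b) d = dpp-left b d

-- A potential on the comb: values fc t on cycle edges and fp t on pendant edges
-- that are close whenever the edges meet (cₜ meets c_{t+1}, pₜ and p_{t+1}).
record CombPotential (fc fp : ℕ → ℕ) : Set where
  field
    along : ∀ t → Close (fc t) (fc (suc t))
    own   : ∀ t → Close (fc t) (fp t)
    ahead : ∀ t → Close (fc t) (fp (suc t))

to-cycleᶜ : ∀ k → CombPotential (λ t → ∣ t - k ∣) (λ t → dpc t k)
to-cycleᶜ k = record { along = λ t → along t k ; own = λ t → own t k ; ahead = λ t → ahead t k }
  where
  along : ∀ t k → Close ∣ t - k ∣ ∣ suc t - k ∣
  along zero zero = close-suc 0
  along zero (suc k) = close-sym (close-suc k)
  along (suc t) zero = close-suc (suc t)
  along (suc t) (suc k) = along t k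
  own : ∀ t k → Close ∣ t - k ∣ (dpc t k)
  own zero k = close-suc k
  own (suc t) zero = close-refl (suc t)
  own (suc t) (suc k) = own t k
  ahead : ∀ t k → Close ∣ t - k ∣ (dpc (suc t) k)
  ahead zero zero = close-suc 0
  ahead zero (suc k) = close-refl (suc k)
  ahead (suc t) zero = close-suc (suc t)
  ahead (suc t) (suc k) = ahead t k

to-pendantᶜ : ∀ k → CombPotential (dpc k) (λ t → dpp t k)
to-pendantᶜ k = record { along = along k ; own = own k ; ahead = ahead k }
  where
  along : ∀ k t → Close (dpc k t) (dpc k (suc t))
  along zero t = close-suc (suc t)
  along (suc zero) zero = close-refl 1
  along (suc (suc k)) zero = close-sym (close-suc (suc k))
  along (suc k) (suc t) = along k t
  own : ∀ k t → Close (dpc k t) (dpp t k)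
  own zero zero = close-sym (close-suc 0)
  own zero (suc t) = close-refl (suc (suc t))
  own (suc k) zero = close-suc (suc k)
  own (suc k) (suc t) = own k t
  ahead : ∀ k t → Close (dpc k t) (dpp (suc t) k)
  ahead zero t = close-suc (suc t)
  ahead (suc zero) zero = close-sym (close-suc 0)
  ahead (suc (suc k)) zero = close-refl (suc (suc k))
  ahead (suc k) (suc t) = ahead k t

-- The sunlet S_n with n = m + 1 (cycle indices 0, …, m); m ≠ 0 so that the
-- cycle has no loops.
module Sunlet (m : ℕ) .{{_ : NonZero m}} where

  n : ℕ
  n = suc m

  Edge : Set
  Edge = SEdge n

  Adj : Edge → Edge → Set
  Adj = SLineAdj n

  next : Fin n → Fin n
  next = sucMod n

  succ : ℕ → ℕ
  succ t = suc t % n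

  toℕ-next : ∀ i → toℕ (next i) ≡ succ (toℕ i)
  toℕ-next i = toℕ-fromℕ< _

  succ-inner : ∀ {t} → t < m → succ t ≡ suc t
  succ-inner t<m = m<n⇒m%n≡m (s≤s t<m)

  succ-last : succ m ≡ 0
  succ-last = n%n≡0 n

  data Position (t : ℕ) : Set where
    inner : t < m → Position t
    last  : t ≡ m → Position t

  position : ∀ {t} → t ≤ m → Position t
  position t≤m with m≤n⇒m<n∨m≡n t≤m
  ... | inj₁ t<m = inner t<m
  ... | inj₂ t≡m = last t≡m

  index≤ : ∀ (i : Fin n) → toℕ i ≤ m
  index≤ i = s≤s⁻¹ (toℕ<n i)

  succ-injective : ∀ {s t} → s ≤ m → t ≤ m → succ s ≡ succ t → s ≡ t
  succ-injective s≤ t≤ eq with position s≤ | position t≤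
  ... | inner s< | inner t< = suc-injective (trans (sym (succ-inner s<)) (trans eq (succ-inner t<)))
  ... | inner s< | last refl = ⊥-elim (1+n≢0 (trans (sym (succ-inner s<)) (trans eq succ-last)))
  ... | last refl | inner t< = ⊥-elim (1+n≢0 (trans (sym (succ-inner t<)) (trans (sym eq) succ-last)))
  ... | last s≡ | last t≡ = trans s≡ (sym t≡)

  next-injective : ∀ {i j} → next i ≡ next j → i ≡ j
  next-injective {i} {j} eq = toℕ-injective (succ-injective (index≤ i) (index≤ j)
    (trans (sym (toℕ-next i)) (trans (cong toℕ eq) (toℕ-next j))))

  next-≢ : ∀ i → i ≢ next i
  next-≢ i eq with position (index≤ i)
  ... | inner t< = 1+n≢n (sym (trans (cong toℕ eq) (trans (toℕ-next i) (succ-inner t<))))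
  ... | last t≡m = ≢-nonZero⁻¹ m (begin
    m                ≡⟨ t≡m ⟨
    toℕ i            ≡⟨ cong toℕ eq ⟩
    toℕ (next i)     ≡⟨ toℕ-next i ⟩
    succ (toℕ i)     ≡⟨ cong succ t≡m ⟩
    succ m           ≡⟨ succ-last ⟩
    0                ∎)
    where open ≡-Reasoning

  -- The three ways two distinct edges of S_n meet; every adjacency of the line
  -- graph is one of them, read in one of the two directions.
  data Touch : Edge → Edge → Set where
    cycle-cycle    : ∀ i → Touch (inj₁ i) (inj₁ (next i))
    cycle-pendant  : ∀ i → Touch (inj₁ i) (inj₂ i)
    cycle-pendant⁺ : ∀ i → Touch (inj₁ i) (inj₂ (next i))

  Adj-sym : ∀ {x y} → Adj x y → Adj y x
  Adj-sym (x≢y , v , x∋v , y∋v) = (λ eq → x≢y (sym eq)) , v , y∋v , x∋v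

  touch-adj : ∀ {x y} → Touch x y → Adj x y
  touch-adj (cycle-cycle i) =
    (λ eq → next-≢ i (inj₁-injective eq)) , inj₁ (next i) , cyc-right i , cyc-left (next i)
  touch-adj (cycle-pendant i) = (λ ()) , inj₁ i , cyc-left i , pen-cycle i
  touch-adj (cycle-pendant⁺ i) = (λ ()) , inj₁ (next i) , cyc-right i , pen-cycle (next i)

  cycle-ends : ∀ {i v} → SInc n (inj₁ i) v → v ≡ inj₁ i ⊎ v ≡ inj₁ (next i)
  cycle-ends (cyc-left _) = inj₁ refl
  cycle-ends (cyc-right _) = inj₂ refl

  pendant-ends : ∀ {i v} → SInc n (inj₂ i) v → v ≡ inj₁ i ⊎ v ≡ inj₂ i
  pendant-ends (pen-cycle _) = inj₁ refl
  pendant-ends (pen-leaf _) = inj₂ refl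

  adj-touch : ∀ {x y} → Adj x y → Touch x y ⊎ Touch y x
  adj-touch {inj₁ i} {inj₁ j} (x≢y , v , x∋v , y∋v) with cycle-ends x∋v | cycle-ends y∋v
  ... | inj₁ refl | inj₁ refl = ⊥-elim (x≢y refl)
  ... | inj₁ refl | inj₂ refl = inj₂ (cycle-cycle j)
  ... | inj₂ refl | inj₁ refl = inj₁ (cycle-cycle i)
  ... | inj₂ refl | inj₂ eq = ⊥-elim (x≢y (cong inj₁ (next-injective (inj₁-injective eq))))
  adj-touch {inj₁ i} {inj₂ j} (_ , v , x∋v , y∋v) with cycle-ends x∋v | pendant-ends y∋v
  ... | inj₁ refl | inj₁ refl = inj₁ (cycle-pendant i)
  ... | inj₂ refl | inj₁ refl = inj₁ (cycle-pendant⁺ i)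
  ... | inj₁ refl | inj₂ ()
  ... | inj₂ refl | inj₂ ()
  adj-touch {inj₂ i} {inj₁ j} (_ , v , x∋v , y∋v) with pendant-ends x∋v | cycle-ends y∋v
  ... | inj₁ refl | inj₁ refl = inj₂ (cycle-pendant j)
  ... | inj₁ refl | inj₂ refl = inj₂ (cycle-pendant⁺ j)
  ... | inj₂ refl | inj₁ ()
  ... | inj₂ refl | inj₂ ()
  adj-touch {inj₂ i} {inj₂ j} (x≢y , v , x∋v , y∋v) with pendant-ends x∋v | pendant-ends y∋v
  ... | inj₁ refl | inj₁ refl = ⊥-elim (x≢y refl)
  ... | inj₂ refl | inj₂ refl = ⊥-elim (x≢y refl)
  ... | inj₁ refl | inj₂ ()
  ... | inj₂ refl | inj₁ ()

  _≟ᵉ_ : DecidableEquality Edge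
  _≟ᵉ_ = ≡-dec _≟ᶠ_ _≟ᶠ_

  search : {P : Fin n ⊎ Fin n → Set} → (∀ x → Dec (P x)) → Dec (Σ (Fin n ⊎ Fin n) P)
  search P? = map′ (λ { (inj₁ (i , p)) → inj₁ i , p ; (inj₂ (i , p)) → inj₂ i , p })
                   (λ { (inj₁ i , p) → inj₁ (i , p) ; (inj₂ i , p) → inj₂ (i , p) })
                   (any? (λ i → P? (inj₁ i)) ⊎-dec any? (λ i → P? (inj₂ i)))

  incident? : ∀ e v → Dec (SInc n e v)
  incident? (inj₁ i) v = map′ (λ { (inj₁ refl) → cyc-left i ; (inj₂ refl) → cyc-right i })
                              cycle-ends (v ≟ᵉ inj₁ i ⊎-dec v ≟ᵉ inj₁ (next i))
  incident? (inj₂ i) v = map′ (λ { (inj₁ refl) → pen-cycle i ; (inj₂ refl) → pen-leaf i })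
                              pendant-ends (v ≟ᵉ inj₁ i ⊎-dec v ≟ᵉ inj₂ i)

  adj? : ∀ x y → Dec (Adj x y)
  adj? x y = ¬? (x ≟ᵉ y) ×-dec search (λ v → incident? x v ×-dec incident? y v)

  open ShortestWalks Adj _≟ᵉ_ adj? search public using (dist-exists)

  -- Walking forward along the cycle without crossing the seam between c_m and c_0.
  forward : ∀ ℓ i j → toℕ i + ℓ ≡ toℕ j → Walk Adj (inj₁ i) (inj₁ j) ℓ
  forward zero i j eq with toℕ-injective {i = i} {j} (trans (sym (+-identityʳ _)) eq)
  ... | refl = nil
  forward (suc ℓ) i j eq = cons (touch-adj (cycle-cycle i)) (forward ℓ (next i) j eq′)
    where
    i<m : toℕ i < m
    i<m = ≤-trans (s≤s (m≤m+n (toℕ i) ℓ))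
                  (≤-trans (≤-reflexive (trans (sym (+-suc _ ℓ)) eq)) (index≤ j))
    eq′ : toℕ (next i) + ℓ ≡ toℕ j
    eq′ = trans (cong (_+ ℓ) (trans (toℕ-next i) (succ-inner i<m))) (trans (sym (+-suc _ ℓ)) eq)

  index : ∀ t → t ≤ m → Fin n
  index t t≤m = fromℕ< (s≤s t≤m)

  toℕ-index : ∀ t t≤m → toℕ (index t t≤m) ≡ t
  toℕ-index t t≤m = toℕ-fromℕ< (s≤s t≤m)

  previous : ∀ i {s} → toℕ i ≡ suc s → Σ (Fin n) λ j → toℕ j ≡ s × next j ≡ i
  previous i {s} eq = j , toℕ-index s s≤m , toℕ-injective (begin
    toℕ (next j)    ≡⟨ toℕ-next j ⟩
    succ (toℕ j)    ≡⟨ cong succ (toℕ-index s s≤m) ⟩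
    succ s          ≡⟨ succ-inner s<m ⟩
    suc s           ≡⟨ eq ⟨
    toℕ i           ∎)
    where
    open ≡-Reasoning
    s<m : s < m
    s<m = ≤-trans (≤-reflexive (sym eq)) (index≤ i)
    s≤m : s ≤ m
    s≤m = <⇒≤ s<m
    j : Fin n
    j = index s s≤m

  next-last : next (index m ≤-refl) ≡ Fin.zero
  next-last = toℕ-injective (trans (toℕ-next _) (trans (cong succ (toℕ-index m ≤-refl)) succ-last))

  record Potential (fc fp : ℕ → ℕ) : Set where
    field
      along : ∀ t → t ≤ m → Close (fc t) (fc (succ t))
      own   : ∀ t → t ≤ m → Close (fc t) (fp t)
      ahead : ∀ t → t ≤ m → Close (fc t) (fp (succ t))

  potential : (ℕ → ℕ) → (ℕ → ℕ) → Edge → ℕ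
  potential fc fp (inj₁ i) = fc (toℕ i)
  potential fc fp (inj₂ i) = fp (toℕ i)

  touch-close : ∀ {fc fp} → Potential fc fp →
                ∀ {x y} → Touch x y → Close (potential fc fp x) (potential fc fp y)
  touch-close {fc} {fp} P (cycle-cycle i) =
    subst (λ z → Close (fc (toℕ i)) (fc z)) (sym (toℕ-next i)) (Potential.along P _ (index≤ i))
  touch-close P (cycle-pendant i) = Potential.own P _ (index≤ i)
  touch-close {fc} {fp} P (cycle-pendant⁺ i) =
    subst (λ z → Close (fc (toℕ i)) (fp z)) (sym (toℕ-next i)) (Potential.ahead P _ (index≤ i))

  potential-lipschitz : ∀ {fc fp} → Potential fc fp →
                        ∀ {x y} → Adj x y → potential fc fp x ≤ suc (potential fc fp y)
  potential-lipschitz P a with adj-touch a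
  ... | inj₁ t = proj₁ (touch-close P t)
  ... | inj₂ t = proj₂ (touch-close P t)

  potential-is-distance : ∀ {fc fp s} → Potential fc fp → potential fc fp s ≡ 0 →
                          (∀ e → Walk Adj e s (potential fc fp e)) → DistanceTo Adj s (potential fc fp)
  potential-is-distance {fc} {fp} P zero-at-s walk e a d =
    dist-unique d (potential-dist (potential fc fp) (potential-lipschitz P) zero-at-s (walk e))

  -- A comb potential is a potential on S_n when it is also close across the
  -- seam, where c_m meets c_0 and p_0.
  close-seam : ∀ {fc fp} → CombPotential fc fp →
               Close (fc m) (fc 0) → Close (fc m) (fp 0) → Potential fc fp
  close-seam {fc} {fp} C seam seam⁺ = record
    { along = along ; own = λ t _ → CombPotential.own C t ; ahead = ahead }
    where
    along : ∀ t → t ≤ m → Close (fc t) (fc (succ t))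
    along t t≤m with position t≤m
    ... | inner t<m = subst (λ z → Close (fc t) (fc z)) (sym (succ-inner t<m)) (CombPotential.along C t)
    ... | last refl = subst (λ z → Close (fc m) (fc z)) (sym succ-last) seam
    ahead : ∀ t → t ≤ m → Close (fc t) (fp (succ t))
    ahead t t≤m with position t≤m
    ... | inner t<m = subst (λ z → Close (fc t) (fp z)) (sym (succ-inner t<m)) (CombPotential.ahead C t)
    ... | last refl = subst (λ z → Close (fc m) (fp z)) (sym succ-last) seam⁺

  rotate : ℕ → ℕ → ℕ
  rotate r t = (t + r) % n

  rotate≤ : ∀ r t → rotate r t ≤ m
  rotate≤ r t = s≤s⁻¹ (m%n<n (t + r) n)

  rotate-succ : ∀ r t → rotate r (succ t) ≡ succ (rotate r t)
  rotate-succ r t = begin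
    (suc t % n + r) % n          ≡⟨ %-distribˡ-+ (suc t % n) r n ⟩
    (suc t % n % n + r % n) % n  ≡⟨ cong (λ z → (z + r % n) % n) (m%n%n≡m%n (suc t) n) ⟩
    (suc t % n + r % n) % n      ≡⟨ %-distribˡ-+ (suc t) r n ⟨
    (1 + (t + r)) % n            ≡⟨ %-distribˡ-+ 1 (t + r) n ⟩
    (1 % n + (t + r) % n) % n    ≡⟨ cong (λ z → (1 % n + z) % n) (m%n%n≡m%n (t + r) n) ⟨
    (1 % n + (t + r) % n % n) % n  ≡⟨ %-distribˡ-+ 1 ((t + r) % n) n ⟨
    succ (rotate r t)            ∎
    where open ≡-Reasoning

  -- Rotating a potential gives a potential: the rotation is a symmetry of S_n.
  rotate-potential : ∀ r {fc fp} → Potential fc fp →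
                     Potential (λ t → fc (rotate r t)) (λ t → fp (rotate r t))
  rotate-potential r {fc} {fp} P = record
    { along = λ t _ → subst (λ z → Close (fc (rotate r t)) (fc z)) (sym (rotate-succ r t))
                            (Potential.along P _ (rotate≤ r t))
    ; own   = λ t _ → Potential.own P _ (rotate≤ r t)
    ; ahead = λ t _ → subst (λ z → Close (fc (rotate r t)) (fp z)) (sym (rotate-succ r t))
                            (Potential.ahead P _ (rotate≤ r t)) }

module OddSunlet (k : ℕ) .{{_ : NonZero k}} where

  instance
    2k-nonZero : NonZero (2 * k)
    2k-nonZero = m*n≢0 2 k

  open Sunlet (2 * k) public

  double : 2 * k ≡ k + k
  double = cong (k +_) (+-identityʳ k)

  k≤2k : k ≤ 2 * k
  k≤2k = ≤-trans (m≤m+n k k) (≤-reflexive (sym double))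

  data Side (t : ℕ) : Set where
    left  : ∀ d → t + suc d ≡ k → Side t
    right : ∀ d r → t ≡ k + d → k ≡ d + r → Side t

  side : ∀ t → t ≤ 2 * k → Side t
  side t t≤2k with t <? k
  ... | yes t<k = left (k ∸ suc t) (trans (+-suc t _) (m+[n∸m]≡n t<k))
  ... | no t≮k = right d (k ∸ d) (sym (m+[n∸m]≡n k≤t)) (sym (m+[n∸m]≡n d≤k))
    where
    k≤t : k ≤ t
    k≤t = ≮⇒≥ t≮k
    d : ℕ
    d = t ∸ k
    d≤k : d ≤ k
    d≤k = ≤-trans (∸-monoˡ-≤ k t≤2k) (≤-reflexive (trans (cong (_∸ k) double) (m+n∸m≡n k k)))

  K : Fin n
  K = index k k≤2k

  toℕ-K : toℕ K ≡ k
  toℕ-K = toℕ-index k k≤2k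

  cₖ pₖ p₀ : Edge
  cₖ = inj₁ K
  pₖ = inj₂ K
  p₀ = inj₂ Fin.zero

  rotate-left : ∀ {t} → t ≤ k → rotate k t ≡ t + k
  rotate-left {t} t≤k = m<n⇒m%n≡m (s≤s (≤-trans (+-monoˡ-≤ k t≤k) (≤-reflexive (sym double))))

  rotate-right : ∀ {d r} → k ≡ d + suc r → rotate k (k + suc d) ≡ d
  rotate-right {d} {r} k≡ = begin
    (k + suc d + k) % n   ≡⟨ cong (_% n) (wrap k d) ⟩
    (d + n) % n           ≡⟨ [m+n]%n≡m%n d n ⟩
    d % n                 ≡⟨ m<n⇒m%n≡m d<n ⟩
    d                     ∎
    where
    open ≡-Reasoning
    wrap : ∀ k d → k + suc d + k ≡ d + suc (2 * k)
    wrap = solve-∀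
    d<k : d < k
    d<k = ≤-trans (s≤s (m≤m+n d r)) (≤-reflexive (trans (sym (+-suc d r)) (sym k≡)))
    d<n : d < n
    d<n = ≤-trans d<k (m≤n⇒m≤1+n k≤2k)

  -- The potentials: on each edge, the length of the comb route to cₖ, pₖ, p₀.
  toCycle toPendant toPendant₀ : Edge → ℕ
  toCycle = potential (λ t → ∣ t - k ∣) (λ t → dpc t k)
  toPendant = potential (dpc k) (λ t → dpp t k)
  toPendant₀ = potential (λ t → dpc k (rotate k t)) (λ t → dpp (rotate k t) k)

  dpc-k-0 : dpc k 0 ≡ k
  dpc-k-0 = trans (cong (λ z → dpc z 0) (sym (suc-pred k))) (trans (dpc-left 0 (pred k)) (suc-pred k))

  dpp-0-k : dpp 0 k ≡ suc k
  dpp-0-k = trans (cong (dpp 0) (sym (suc-pred k))) (trans (dpp-right 0 (pred k)) (cong suc (suc-pred k)))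

  ∣2k-k∣ : ∣ 2 * k - k ∣ ≡ k
  ∣2k-k∣ = trans (cong (λ z → ∣ z - k ∣) double) (trans (∣-∣-comm (k + k) k) (∣m-m+n∣≡n k k))

  dpc-k-2k : dpc k (2 * k) ≡ suc k
  dpc-k-2k = trans (cong (dpc k) double) (dpc-right k k)

  toCycle-potential : Potential (λ t → ∣ t - k ∣) (λ t → dpc t k)
  toCycle-potential = close-seam (to-cycleᶜ k)
    (subst (λ z → Close z k) (sym ∣2k-k∣) (close-refl k))
    (subst (λ z → Close z (suc k)) (sym ∣2k-k∣) (close-suc k))

  toPendant-potential : Potential (dpc k) (λ t → dpp t k)
  toPendant-potential = close-seam (to-pendantᶜ k)
    (subst₂ Close (sym dpc-k-2k) (sym dpc-k-0) (close-sym (close-suc k)))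
    (subst₂ Close (sym dpc-k-2k) (sym dpp-0-k) (close-refl (suc k)))

  -- p₀ is the image of pₖ under rotation, so its potential is the rotated one.
  toPendant₀-potential : Potential (λ t → dpc k (rotate k t)) (λ t → dpp (rotate k t) k)
  toPendant₀-potential = rotate-potential k toPendant-potential

  code : Edge → ℕ
  code (inj₁ i) = suc (2 * toℕ i)
  code (inj₂ i) = 2 * toℕ i

  code-injective : ∀ {e f} → code e ≡ code f → e ≡ f
  code-injective {inj₁ i} {inj₁ j} eq = cong inj₁ (toℕ-injective (*-cancelˡ-≡ _ _ 2 (suc-injective eq)))
  code-injective {inj₁ i} {inj₂ j} eq = ⊥-elim (even≢odd (toℕ j) (toℕ i) (sym eq))
  code-injective {inj₂ i} {inj₁ j} eq = ⊥-elim (even≢odd (toℕ i) (toℕ j) eq)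
  code-injective {inj₂ i} {inj₂ j} eq = cong inj₂ (toℕ-injective (*-cancelˡ-≡ _ _ 2 eq))

  -- Reading the code of an edge off its potentials u, v, w (towards cₖ, pₖ, p₀):
  -- (u + 1) ∸ v is 2 at pₖ, 1 left of the middle and 0 elsewhere; the code is
  -- (w + k) ∸ u on the left and (u + 3k + 2) ∸ w on the right.
  select : ℕ → ℕ → ℕ → ℕ
  select zero b₀ b₁ = b₀
  select (suc zero) b₀ b₁ = b₁
  select (suc (suc _)) b₀ b₁ = 2 * k

  readout : ℕ → ℕ → ℕ → ℕ
  readout u v w = select ((u + 1) ∸ v) ((u + suc (n + k)) ∸ w) ((w + k) ∸ u)

  readout-cong : ∀ u v w u′ v′ w′ → u + v′ ≡ u′ + v → u + w′ ≡ u′ + w →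
                 readout u v w ≡ readout u′ v′ w′
  readout-cong u v w u′ v′ w′ eqᵛ eqʷ =
    cong₂ (λ (a , b₀) b₁ → select a b₀ b₁)
          (cong₂ _,_ (offset-diff-cong 1 u v u′ v′ eqᵛ) (offset-diff-cong (suc (n + k)) u w u′ w′ eqʷ))
          (offset-diff-cong k w u w′ u′ flipped)
    where
    flipped : w + u′ ≡ w′ + u
    flipped = trans (+-comm w u′) (trans (sym eqʷ) (+-comm u w′))

  readout-left : ∀ u v w → (u + 1) ∸ v ≡ 1 → readout u v w ≡ (w + k) ∸ u
  readout-left u v w eq = cong (λ a → select a ((u + suc (n + k)) ∸ w) ((w + k) ∸ u)) eq

  readout-right : ∀ u v w → (u + 1) ∸ v ≡ 0 → readout u v w ≡ (u + suc (n + k)) ∸ w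
  readout-right u v w eq = cong (λ a → select a ((u + suc (n + k)) ∸ w) ((w + k) ∸ u)) eq

  readout-cycle-left : ∀ {t d} → t + suc d ≡ k → readout (suc d) (suc d) (suc t) ≡ suc (2 * t)
  readout-cycle-left {t} {d} eq = trans (readout-left (suc d) (suc d) (suc t) (m+n∸m≡n d 1))
    (∸-from-+ (trans (identity t d) (cong (suc t +_) eq)))
    where
    identity : ∀ t d → suc (2 * t) + suc d ≡ suc t + (t + suc d)
    identity = solve-∀

  readout-cycle-right : ∀ {d r} → k ≡ d + r → readout d (suc d) (suc r) ≡ suc (2 * (k + d))
  readout-cycle-right {d} {r} eq =
    trans (readout-right d (suc d) (suc r) (m≤n⇒m∸n≡0 (≤-reflexive (+-comm d 1))))
      (∸-from-+ (subst (λ k′ → suc (2 * (k′ + d)) + suc r ≡ d + suc (suc (2 * k′) + k′))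
                       (sym eq) (identity d r)))
    where
    identity : ∀ d r → suc (2 * ((d + r) + d)) + suc r ≡ d + suc (suc (2 * (d + r)) + (d + r))
    identity = solve-∀

  readout-pendant-left : ∀ {t d} → t + suc d ≡ k →
                         readout (suc (suc d)) (suc (suc d)) (suc t) ≡ 2 * t
  readout-pendant-left {t} {d} eq =
    trans (readout-left (suc (suc d)) (suc (suc d)) (suc t) (m+n∸m≡n d 1))
      (∸-from-+ (trans (identity t d) (cong (suc t +_) eq)))
    where
    identity : ∀ t d → 2 * t + suc (suc d) ≡ suc t + (t + suc d)
    identity = solve-∀

  readout-p₀ : ∀ {d} → suc d ≡ k → readout (suc (suc d)) (suc (suc d)) 0 ≡ 0
  readout-p₀ {d} eq = trans (readout-left (suc (suc d)) (suc (suc d)) 0 (m+n∸m≡n d 1))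
    (m≤n⇒m∸n≡0 (≤-trans (≤-reflexive (sym eq)) (n≤1+n (suc d))))

  readout-pendant-right : ∀ {d r} → k ≡ d + suc r →
                          readout (suc d) (suc (suc d)) (suc (suc r)) ≡ 2 * (k + suc d)
  readout-pendant-right {d} {r} eq =
    trans (readout-right (suc d) (suc (suc d)) (suc (suc r)) (m≤n⇒m∸n≡0 (≤-reflexive (+-comm d 1))))
      (∸-from-+ (subst (λ k′ → 2 * (k′ + suc d) + suc (suc r) ≡ suc d + suc (suc (2 * k′) + k′))
                       (sym eq) (identity d r)))
    where
    identity : ∀ d r → 2 * ((d + suc r) + suc d) + suc (suc r) ≡
                       suc d + suc (suc (2 * (d + suc r)) + (d + suc r))
    identity = solve-∀

  via-own : ∀ {i x ℓ} → Walk Adj (inj₁ i) x ℓ → Walk Adj (inj₂ i) x (suc ℓ)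
  via-own {i} w = cons (Adj-sym (touch-adj (cycle-pendant i))) w

  via-previous : ∀ i {s x ℓ} → toℕ i ≡ suc s →
                 (∀ j → toℕ j ≡ s → Walk Adj (inj₁ j) x ℓ) → Walk Adj (inj₂ i) x (suc ℓ)
  via-previous i eq walk with previous i eq
  ... | j , toℕ-j , refl = cons (Adj-sym (touch-adj (cycle-pendant⁺ j))) (walk j toℕ-j)

  forward-to-cₖ : ∀ i d → toℕ i + suc d ≡ k → Walk Adj (inj₁ i) cₖ (suc d)
  forward-to-cₖ i d eq = forward (suc d) i K (trans eq (sym toℕ-K))

  forward-to-pₖ : ∀ i d → toℕ i + suc d ≡ k → Walk Adj (inj₁ i) pₖ (suc d)
  forward-to-pₖ i d eq with previous K (trans toℕ-K (trans (sym eq) (+-suc (toℕ i) d)))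
  ... | j , toℕ-j , next-j = subst (λ z → Walk Adj (inj₁ i) (inj₂ z) (suc d)) next-j
                               (snocʷ (forward d i j (sym toℕ-j)) (touch-adj (cycle-pendant⁺ j)))

  back-to-cₖ : ∀ i d → toℕ i ≡ k + d → Walk Adj (inj₁ i) cₖ d
  back-to-cₖ i d eq = reverseʷ Adj-sym (forward d K i (trans (cong (_+ d) toℕ-K) (sym eq)))

  back-to-pₖ : ∀ i d → toℕ i ≡ k + d → Walk Adj (inj₁ i) pₖ (suc d)
  back-to-pₖ i d eq = snocʷ (back-to-cₖ i d eq) (touch-adj (cycle-pendant K))

  back-to-p₀ : ∀ i {t} → toℕ i ≡ t → Walk Adj (inj₁ i) p₀ (suc t)
  back-to-p₀ i eq =
    snocʷ (reverseʷ Adj-sym (forward _ Fin.zero i (sym eq))) (touch-adj (cycle-pendant Fin.zero))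

  last-edge : Fin n
  last-edge = index (2 * k) ≤-refl

  to-last : ∀ i r → toℕ i + r ≡ 2 * k → Walk Adj (inj₁ i) (inj₁ last-edge) r
  to-last i r eq = forward r i last-edge (trans eq (sym (toℕ-index (2 * k) ≤-refl)))

  ahead-to-p₀ : ∀ i r → toℕ i + r ≡ 2 * k → Walk Adj (inj₁ i) p₀ (suc r)
  ahead-to-p₀ i r eq = subst (λ z → Walk Adj (inj₁ i) (inj₂ z) (suc r)) next-last
    (snocʷ (to-last i r eq) (touch-adj (cycle-pendant⁺ last-edge)))

  ahead-to-c₀ : ∀ i r → toℕ i + r ≡ 2 * k → Walk Adj (inj₁ i) (inj₁ Fin.zero) (suc r)
  ahead-to-c₀ i r eq = subst (λ z → Walk Adj (inj₁ i) (inj₁ z) (suc r)) next-last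
    (snocʷ (to-last i r eq) (touch-adj (cycle-cycle last-edge)))

  record Located (e : Edge) : Set where
    field
      to-cₖ : Walk Adj e cₖ (toCycle e)
      to-pₖ : Walk Adj e pₖ (toPendant e)
      to-p₀ : Walk Adj e p₀ (toPendant₀ e)
      readout-code : readout (toCycle e) (toPendant e) (toPendant₀ e) ≡ code e

  located : ∀ {e u v w} → toCycle e ≡ u → toPendant e ≡ v → toPendant₀ e ≡ w →
            Walk Adj e cₖ u → Walk Adj e pₖ v → Walk Adj e p₀ w → readout u v w ≡ code e →
            Located e
  located refl refl refl to-cₖ to-pₖ to-p₀ readout-code =
    record { to-cₖ = to-cₖ ; to-pₖ = to-pₖ ; to-p₀ = to-p₀ ; readout-code = readout-code }

  rotated-right : ∀ d r → k ≡ d + r → dpc k (rotate k (k + d)) ≡ suc r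
  rotated-right zero r eq = begin
    dpc k (rotate k (k + 0))  ≡⟨ cong (λ t → dpc k (rotate k t)) (+-identityʳ k) ⟩
    dpc k (rotate k k)        ≡⟨ cong (dpc k) (rotate-left ≤-refl) ⟩
    dpc k (k + k)             ≡⟨ dpc-right k k ⟩
    suc k                     ≡⟨ cong suc eq ⟩
    suc r                     ∎
    where open ≡-Reasoning
  rotated-right (suc d) r eq = begin
    dpc k (rotate k (k + suc d))  ≡⟨ cong (dpc k) (rotate-right k≡) ⟩
    dpc k d                       ≡⟨ cong (λ k′ → dpc k′ d) k≡ ⟩
    dpc (d + suc r) d             ≡⟨ dpc-left d r ⟩
    suc r                         ∎
    where
    open ≡-Reasoning
    k≡ : k ≡ d + suc r
    k≡ = trans eq (sym (+-suc d r))

  cycle-left : ∀ i d → toℕ i + suc d ≡ k → Located (inj₁ i)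
  cycle-left i d eq = located
    (trans (cong (λ k′ → ∣ toℕ i - k′ ∣) (sym eq)) (∣m-m+n∣≡n (toℕ i) (suc d)))
    (trans (cong (λ k′ → dpc k′ (toℕ i)) (sym eq)) (dpc-left (toℕ i) d))
    (trans (cong (dpc k) (trans (rotate-left i≤k) (+-comm (toℕ i) k))) (dpc-right k (toℕ i)))
    (forward-to-cₖ i d eq) (forward-to-pₖ i d eq) (back-to-p₀ i refl) (readout-cycle-left eq)
    where
    i≤k : toℕ i ≤ k
    i≤k = ≤-trans (m≤m+n (toℕ i) (suc d)) (≤-reflexive eq)

  cycle-right : ∀ i d r → toℕ i ≡ k + d → k ≡ d + r → Located (inj₁ i)
  cycle-right i d r eq₁ eq₂ = located
    (trans (cong (λ t → ∣ t - k ∣) eq₁) (trans (∣-∣-comm (k + d) k) (∣m-m+n∣≡n k d)))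
    (trans (cong (dpc k) eq₁) (dpc-right k d))
    (trans (cong (λ t → dpc k (rotate k t)) eq₁) (rotated-right d r eq₂))
    (back-to-cₖ i d eq₁) (back-to-pₖ i d eq₁) (ahead-to-p₀ i r reaches-2k)
    (trans (readout-cycle-right eq₂) (cong (λ t → suc (2 * t)) (sym eq₁)))
    where
    reaches-2k : toℕ i + r ≡ 2 * k
    reaches-2k = begin
      toℕ i + r    ≡⟨ cong (_+ r) eq₁ ⟩
      k + d + r    ≡⟨ +-assoc k d r ⟩
      k + (d + r)  ≡⟨ cong (k +_) eq₂ ⟨
      k + k        ≡⟨ double ⟨
      2 * k        ∎
      where open ≡-Reasoning

  pendant-left : ∀ i d → toℕ i + suc d ≡ k → Located (inj₂ i)
  pendant-left Fin.zero d eq = located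
    (cong suc (sym eq)) (trans (cong (dpp 0) (sym eq)) (dpp-right 0 d))
    (trans (cong (λ t → dpp t k) (rotate-left z≤n)) (dpp-self k))
    (via-own (forward-to-cₖ Fin.zero d eq)) (via-own (forward-to-pₖ Fin.zero d eq)) nil (readout-p₀ eq)
  pendant-left i@(Fin.suc i′) d eq = located
    (trans (cong (dpc t) (sym eq)) (dpc-right t (suc d)))
    (trans (cong (dpp t) (sym eq)) (dpp-right t d))
    (trans (cong (λ z → dpp z k) (trans (rotate-left t≤k) (+-comm t k))) (dpp-left k (toℕ i′)))
    (via-own (forward-to-cₖ i d eq)) (via-own (forward-to-pₖ i d eq))
    (via-previous i refl (λ j toℕ-j → back-to-p₀ j toℕ-j)) (readout-pendant-left {t} eq)
    where
    t : ℕ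
    t = toℕ i
    t≤k : t ≤ k
    t≤k = ≤-trans (m≤m+n t (suc d)) (≤-reflexive eq)

  pendant-centre : ∀ i → toℕ i ≡ k → Located (inj₂ i)
  pendant-centre i eq with toℕ-injective {i = i} {K} (trans eq (sym toℕ-K))
  ... | refl = located
    (trans (cong (λ t → dpc t k) toℕ-K) (trans (cong (dpc k) (sym (+-identityʳ k))) (dpc-right k 0)))
    (trans (cong (λ t → dpp t k) toℕ-K) (dpp-self k))
    (trans (cong (λ t → dpp (rotate k t) k) toℕ-K) (trans (cong (λ t → dpp t k) (rotate-left ≤-refl))
           (trans (cong (λ k′ → dpp (k + k′) k) (sym (suc-pred k))) (dpp-left k (pred k)))))
    (via-own nil) nil (via-previous K k≡suc (λ j toℕ-j → back-to-p₀ j toℕ-j))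
    (cong (2 *_) (sym toℕ-K))
    where
    k≡suc : toℕ K ≡ suc (pred k)
    k≡suc = trans toℕ-K (sym (suc-pred k))

  pendant-right : ∀ i d r → toℕ i ≡ k + suc d → k ≡ d + suc r → Located (inj₂ i)
  pendant-right i d r eq₁ eq₂ = located
    (trans (cong (λ t → dpc t k) eq₁) (dpc-left k d))
    (trans (cong (λ t → dpp t k) eq₁) (dpp-left k d))
    (trans (cong (λ t → dpp (rotate k t) k) eq₁)
           (trans (cong (λ t → dpp t k) (rotate-right eq₂)) (trans (cong (dpp d) eq₂) (dpp-right d r))))
    (via-previous i i≡suc (λ j toℕ-j → back-to-cₖ j d toℕ-j))
    (via-previous i i≡suc (λ j toℕ-j → back-to-pₖ j d toℕ-j))
    (via-own (ahead-to-p₀ i r reaches-2k))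
    (trans (readout-pendant-right eq₂) (cong (2 *_) (sym eq₁)))
    where
    i≡suc : toℕ i ≡ suc (k + d)
    i≡suc = trans eq₁ (+-suc k d)
    reaches-2k : toℕ i + r ≡ 2 * k
    reaches-2k = begin
      toℕ i + r        ≡⟨ cong (_+ r) eq₁ ⟩
      k + suc d + r    ≡⟨ +-assoc k (suc d) r ⟩
      k + suc (d + r)  ≡⟨ cong (k +_) (+-suc d r) ⟨
      k + (d + suc r)  ≡⟨ cong (k +_) eq₂ ⟨
      k + k            ≡⟨ double ⟨
      2 * k            ∎
      where open ≡-Reasoning

  locate : ∀ e → Located e
  locate (inj₁ i) with side (toℕ i) (index≤ i)
  ... | left d eq = cycle-left i d eq
  ... | right d r eq₁ eq₂ = cycle-right i d r eq₁ eq₂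
  locate (inj₂ i) with side (toℕ i) (index≤ i)
  ... | left d eq = pendant-left i d eq
  ... | right zero r eq₁ _ = pendant-centre i (trans eq₁ (+-identityʳ k))
  ... | right (suc d) r eq₁ eq₂ = pendant-right i d r eq₁ (trans eq₂ (sym (+-suc d r)))

  distance-to-cₖ : DistanceTo Adj cₖ toCycle
  distance-to-cₖ = potential-is-distance toCycle-potential
    (trans (cong (λ t → ∣ t - k ∣) toℕ-K) (∣n-n∣≡0 k)) (λ e → Located.to-cₖ (locate e))

  distance-to-pₖ : DistanceTo Adj pₖ toPendant
  distance-to-pₖ = potential-is-distance toPendant-potential
    (trans (cong (λ t → dpp t k) toℕ-K) (dpp-self k)) (λ e → Located.to-pₖ (locate e))

  distance-to-p₀ : DistanceTo Adj p₀ toPendant₀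
  distance-to-p₀ = potential-is-distance toPendant₀-potential
    (trans (cong (λ t → dpp t k) (rotate-left z≤n)) (dpp-self k)) (λ e → Located.to-p₀ (locate e))

  signature-determines : ∀ e f → toCycle e + toPendant f ≡ toCycle f + toPendant e →
                         toCycle e + toPendant₀ f ≡ toCycle f + toPendant₀ e → e ≡ f
  signature-determines e f eqᵛ eqʷ = code-injective (begin
    code e                                             ≡⟨ Located.readout-code (locate e) ⟨
    readout (toCycle e) (toPendant e) (toPendant₀ e)   ≡⟨ same-readout ⟩
    readout (toCycle f) (toPendant f) (toPendant₀ f)   ≡⟨ Located.readout-code (locate f) ⟩
    code f                                             ∎)
    where
    open ≡-Reasoning
    same-readout : readout (toCycle e) (toPendant e) (toPendant₀ e) ≡
                   readout (toCycle f) (toPendant f) (toPendant₀ f)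
    same-readout = readout-cong (toCycle e) (toPendant e) (toPendant₀ e)
                                (toCycle f) (toPendant f) (toPendant₀ f) eqᵛ eqʷ

  resolving : IsEdgeDRS Adj (cₖ ∷ pₖ ∷ p₀ ∷ [])
  resolving = three-resolving Adj distance-to-cₖ distance-to-pₖ distance-to-p₀ signature-determines

  resolving-unique : Unique (cₖ ∷ pₖ ∷ p₀ ∷ [])
  resolving-unique = ((λ ()) ∷ (λ ()) ∷ []) ∷ (pₖ≢p₀ ∷ []) ∷ [] ∷ []
    where
    pₖ≢p₀ : pₖ ≢ p₀
    pₖ≢p₀ eq = ≢-nonZero⁻¹ k (trans (sym toℕ-K) (cong toℕ (inj₂-injective eq)))

  -- Two cycle edges cᵢ, cⱼ with i ≤ j are joined by a walk of length at most k:
  -- forward if j - i ≤ k, and otherwise across the seam.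
  cycle-walk-≤ : ∀ i j → toℕ i ≤ toℕ j →
                 Σ ℕ λ ℓ → ℓ ≤ k × Walk Adj (inj₁ i) (inj₁ j) ℓ
  cycle-walk-≤ i j i≤j with toℕ j ∸ toℕ i ≤? k
  ... | yes short = _ , short , forward _ i j (m+[n∸m]≡n i≤j)
  ... | no long = suc q + toℕ i , short-way-round , reverseʷ Adj-sym
      (ahead-to-c₀ j q j+q≡2k ++ʷ forward (toℕ i) Fin.zero i refl)
    where
    q δ : ℕ
    q = 2 * k ∸ toℕ j
    δ = toℕ j ∸ toℕ i
    j+q≡2k : toℕ j + q ≡ 2 * k
    j+q≡2k = m+[n∸m]≡n (index≤ j)
    once-round : (suc q + toℕ i) + δ ≡ k + suc k
    once-round = begin
      (suc q + toℕ i) + δ   ≡⟨ cong suc (+-assoc q (toℕ i) δ) ⟩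
      suc (q + (toℕ i + δ)) ≡⟨ cong (λ z → suc (q + z)) (m+[n∸m]≡n i≤j) ⟩
      suc (q + toℕ j)       ≡⟨ cong suc (trans (+-comm q (toℕ j)) j+q≡2k) ⟩
      suc (2 * k)           ≡⟨ cong suc double ⟩
      suc (k + k)           ≡⟨ +-suc k k ⟨
      k + suc k             ∎
      where open ≡-Reasoning
    short-way-round : suc q + toℕ i ≤ k
    short-way-round = +-cancelʳ-≤ δ _ _ (≤-trans (≤-reflexive once-round) (+-monoʳ-≤ k (≰⇒> long)))

  cycle-walk : ∀ i j → Σ ℕ λ ℓ → ℓ ≤ k × Walk Adj (inj₁ i) (inj₁ j) ℓ
  cycle-walk i j with ≤-total (toℕ i) (toℕ j)
  ... | inj₁ i≤j = cycle-walk-≤ i j i≤j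
  ... | inj₂ j≤i with cycle-walk-≤ j i j≤i
  ...   | ℓ , ℓ≤k , w = ℓ , ℓ≤k , reverseʷ Adj-sym w

  within : ∀ {ℓ} a → a ≤ 2 → ℓ ≤ k → a + ℓ ≤ k + 2
  within a a≤2 ℓ≤k = ≤-trans (+-mono-≤ a≤2 ℓ≤k) (≤-reflexive (+-comm 2 k))

  walk-≤ : ∀ x y → Σ ℕ λ ℓ → ℓ ≤ k + 2 × Walk Adj x y ℓ
  walk-≤ (inj₁ i) (inj₁ j) with cycle-walk i j
  ... | ℓ , ℓ≤k , w = ℓ , within 0 z≤n ℓ≤k , w
  walk-≤ (inj₁ i) (inj₂ j) with cycle-walk i j
  ... | ℓ , ℓ≤k , w = suc ℓ , within 1 (s≤s z≤n) ℓ≤k , snocʷ w (touch-adj (cycle-pendant j))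
  walk-≤ (inj₂ i) (inj₁ j) with cycle-walk i j
  ... | ℓ , ℓ≤k , w = suc ℓ , within 1 (s≤s z≤n) ℓ≤k , via-own w
  walk-≤ (inj₂ i) (inj₂ j) with cycle-walk i j
  ... | ℓ , ℓ≤k , w = suc (suc ℓ) , within 2 ≤-refl ℓ≤k ,
                      via-own (snocʷ w (touch-adj (cycle-pendant j)))

  bounded-distance : ∀ x y → Σ ℕ λ d → Dist Adj x y d × d ≤ k + 2
  bounded-distance x y with walk-≤ x y
  ... | ℓ , ℓ≤ , w with dist-exists w
  ...   | d , shortest , d≤ℓ = d , shortest , ≤-trans d≤ℓ ℓ≤

  distance : Edge → Edge → ℕ
  distance x y = proj₁ (bounded-distance x y)

  distance-spec : ∀ x y → Dist Adj x y (distance x y)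
  distance-spec x y = proj₁ (proj₂ (bounded-distance x y))

  distance-≤ : ∀ x y → distance x y ≤ k + 2
  distance-≤ x y = proj₂ (proj₂ (bounded-distance x y))

  -- For k ≥ 2 the 2n = 4k + 2 edges outnumber the 2(k + 2) + 1 possible
  -- differences of distances, so no two edges doubly resolve S_n.
  enough-edges : 2 ≤ k → suc ((k + 2) + (k + 2)) < n + n
  enough-edges 2≤k = begin-strict
    suc ((k + 2) + (k + 2))         <⟨ n<1+n _ ⟩
    suc (suc ((k + 2) + (k + 2)))   ≡⟨ small k ⟩
    (k + k) + (2 + 2) + 2           ≤⟨ +-monoˡ-≤ 2 (+-monoʳ-≤ (k + k) (+-mono-≤ 2≤k 2≤k)) ⟩
    (k + k) + (k + k) + 2           ≡⟨ large k ⟩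
    n + n                           ∎
    where
    open ≤-Reasoning
    small : ∀ k → suc (suc ((k + 2) + (k + 2))) ≡ (k + k) + (2 + 2) + 2
    small = solve-∀
    large : ∀ k → (k + k) + (k + k) + 2 ≡ suc (2 * k) + suc (2 * k)
    large = solve-∀

  splitAt-injective : ∀ {x y} → splitAt n {n} x ≡ splitAt n y → x ≡ y
  splitAt-injective {x} {y} eq =
    trans (sym (join-splitAt n n x)) (trans (cong (join n n) eq) (join-splitAt n n y))

  lower-bound : 2 ≤ k → ∀ D → IsEdgeDRS Adj D → 3 ≤ length D
  lower-bound 2≤k = AtLeastThree.lower-bound Adj distance distance-spec (k + 2) distance-≤
                      (splitAt n) splitAt-injective (enough-edges 2≤k)

lemma2p3 : (k : ℕ) → 2 ≤ k → PsiE≡ (SLineAdj (suc (2 * k))) 3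
lemma2p3 k 2≤k =
  (cₖ ∷ pₖ ∷ p₀ ∷ [] , resolving-unique , refl , resolving) , λ D _ → lower-bound 2≤k D
  where
  instance
    k-nonZero : NonZero k
    k-nonZero = >-nonZero (<-≤-trans (s≤s z≤n) 2≤k)
  open OddSunlet k
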